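{- In the Ctrie algorithm described in the context, if a successful CAS instruction makes an inode $in$ unreachable from its parent at some time $t_0$, then $in$ is nonlive at $t_0$ (that is, $in.main$ is $null$ or a tombed snode at $t_0$).
   Context: A Ctrie is a concurrent shared-memory map accessed by threads using atomic reads and single-word compare-and-swap CAS$(x,e,n)$ (atomically: if $x$ holds $e$, write $n$ and succeed; else fail). Nodes: an inode has a mutable field $main$ ($null$, a cnode, or an snode); a cnode has an immutable bitmap and an immutable array of references to inodes or snodes; an snode has immutable key, value and tomb flag. A mutable reference $root$ holds $null$ or an inode. An inode is live iff its $main$ is a cnode; a null-inode has $main=null$, a tomb-inode has $main$ a tombed snode; nonlive inodes are null-inodes and tomb-inodes. The parent of an inode is the inode whose $main$ cnode contains it (or the $root$ reference). The successful CAS instructions of the algorithm are: (a) CAS of $root$ from $r$ to a new inode or to $null$, performed only after $r$ was checked to be $null$ or a null-inode; (b) CAS of $i.main$ from a cnode $cn$ to a copy of $cn$ with an entry added, with an snode entry replaced by a new snode, or with an snode entry replaced by a new inode (insertion); (c) CAS of $i.main$ from $cn$ to a copy of $cn$ with one snode entry removed, or to $null$ if $cn$ had only that entry (removal); (d) CAS of $i.main$ from a cnode $m$ to its compression: if $m$ has exactly one entry which is a tomb-inode, its tombed snode; otherwise $m$ with null-inode entries removed and tomb-inode entries replaced by untombed copies of their snodes ($null$ if nothing remains); (e) CAS of $i.main$ from a cnode $m$ to its weak tombing: after dropping null-inode entries, $m$ itself if more than one entry remains, a tombed copy of the remaining entry's key/value if exactly one remains and it is an snode or tomb-inode, the one-entry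 cnode if one remains otherwise, $null$ if none remain; (f) CAS of $parent.main$ from a cnode $cn$ containing an inode $i$ to $cn$ without the entry $i$, performed after reading $i.main=null$, or to $cn$ with $i$ replaced by an untombed copy of $i$'s snode, performed after reading that $i.main$ is a tombed snode. Whenever an inode's $main$ is a null or tombed snode, it is never written afterwards. -}

module Defs where

open import Data.Nat using (ℕ; zero; suc)
open import Data.Bool using (Bool; true; false)
open import Data.List using (List; []; _∷_; _++_; [_]; length)
open import Data.Maybe using (Maybe; just; nothing)
open import Data.Product using (Σ; ∃; _×_; _,_)
open import Data.Sum using (_⊎_)
open import Relation.Binary.PropositionalEquality using (_≡_; _≢_)
open import Relation.Nullary using (¬_)
open import Data.List.Membership.Propositional using (_∈_)

-- Nodes of the Ctrie.  Keys and values are modelled as natural numbers.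
-- Inodes are identified by their address (an index into the heap).

record SNode : Set where
  constructor mkSNode
  field
    key   : ℕ
    value : ℕ
    tomb  : Bool

open SNode public

data Branch : Set where
  inodeRef : ℕ → Branch
  snodeRef : SNode → Branch

record CNode : Set where
  constructor mkCNode
  field
    bitmap : ℕ
    array  : List Branch

open CNode public

data Main : Set where
  nullM  : Main
  cnodeM : CNode → Main
  snodeM : SNode → Main

-- global shared memory: the main field of every allocated inode
-- (address = position in the list) and the root reference
record State : Set where
  constructor mkState
  field
    heap : List Main
    root : Maybe ℕ

open State public

initial : State
initial = mkState [] nothing

_!_ : {A : Set} → List A → ℕ → Maybe A
[] ! _ = nothing
(x ∷ xs) ! zero = just x
(x ∷ xs) ! suc n = xs ! n

update : {A : Set} → List A → ℕ → A → List A
update [] _ _ = []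
update (x ∷ xs) zero a = a ∷ xs
update (x ∷ xs) (suc n) a = x ∷ update xs n a

mainOf : State → ℕ → Maybe Main
mainOf s i = heap s ! i

setMain : State → ℕ → Main → State
setMain s i m = mkState (update (heap s) i m) (root s)

alloc : State → Main → State
alloc s m = mkState (heap s ++ [ m ]) (root s)

fresh : State → ℕ
fresh s = length (heap s)

IsNullINode : State → ℕ → Set
IsNullINode s i = mainOf s i ≡ just nullM

IsTombINode : State → ℕ → Set
IsTombINode s i = Σ SNode λ x → mainOf s i ≡ just (snodeM x) × tomb x ≡ true

Live : State → ℕ → Set
Live s i = Σ CNode λ c → mainOf s i ≡ just (cnodeM c)

Nonlive : State → ℕ → Set
Nonlive s i = IsNullINode s i ⊎ IsTombINode s i

data Status : Set where
  nullI  : Status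
  tombI  : SNode → Status
  otherI : Status

statusMain : Maybe Main → Status
statusMain (just nullM) = nullI
statusMain (just (snodeM x)) with tomb x
... | true = tombI x
... | false = otherI
statusMain _ = otherI

status : State → ℕ → Status
status s i = statusMain (mainOf s i)

untomb : SNode → SNode
untomb x = mkSNode (key x) (value x) false

tombed : SNode → SNode
tombed x = mkSNode (key x) (value x) true

-- compression (case (d)), computed w.r.t. a state σ in which the
-- statuses of the inode entries were read; b' is the new bitmap

compressEntries : State → List Branch → List Branch
compressEntries σ [] = []
compressEntries σ (snodeRef x ∷ bs) = snodeRef x ∷ compressEntries σ bs
compressEntries σ (inodeRef i ∷ bs) with status σ i
... | nullI = compressEntries σ bs
... | tombI x = snodeRef (untomb x) ∷ compressEntries σ bs
... | otherI = inodeRef i ∷ compressEntries σ bs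

cnodeOrNull : ℕ → List Branch → Main
cnodeOrNull b' [] = nullM
cnodeOrNull b' (e ∷ es) = cnodeM (mkCNode b' (e ∷ es))

compressGeneral : State → CNode → ℕ → Main
compressGeneral σ m b' = cnodeOrNull b' (compressEntries σ (array m))

compressSingle : State → CNode → ℕ → ℕ → Main
compressSingle σ m b' i with status σ i
... | tombI x = snodeM x
... | _ = compressGeneral σ m b'

compression : State → CNode → ℕ → Main
compression σ m b' with array m
... | inodeRef i ∷ [] = compressSingle σ m b' i
... | _ = compressGeneral σ m b'

dropNull : State → List Branch → List Branch
dropNull σ [] = []
dropNull σ (snodeRef x ∷ bs) = snodeRef x ∷ dropNull σ bs
dropNull σ (inodeRef i ∷ bs) with status σ i
... | nullI = dropNull σ bs
... | _ = inodeRef i ∷ dropNull σ bs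

weakTombOne : State → ℕ → Branch → Main
weakTombOne σ b' (snodeRef x) = snodeM (tombed x)
weakTombOne σ b' (inodeRef i) with status σ i
... | tombI x = snodeM (tombed x)
... | _ = cnodeM (mkCNode b' (inodeRef i ∷ []))

weakTombFrom : State → CNode → ℕ → List Branch → Main
weakTombFrom σ m b' [] = nullM
weakTombFrom σ m b' (e ∷ []) = weakTombOne σ b' e
weakTombFrom σ m b' (_ ∷ _ ∷ _) = cnodeM m

weakTombing : State → CNode → ℕ → Main
weakTombing σ m b' = weakTombFrom σ m b' (dropNull σ (array m))

-- the successful CAS instructions.  'past' are the earlier states of the
-- execution, s is the current state; reads performed earlier by the
-- thread are modelled by a snapshot σ ∈ s ∷ past.

data Step (past : List State) (s : State) : State → Set where
  rootNew : ∀ {σ} → σ ∈ s ∷ past →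
    (root s ≡ nothing ⊎ Σ ℕ λ a → root s ≡ just a × mainOf σ a ≡ just nullM) →
    (m : Main) →
    Step past s (mkState (heap (alloc s m)) (just (fresh s)))
  rootNull : ∀ {σ} → σ ∈ s ∷ past →
    (root s ≡ nothing ⊎ Σ ℕ λ a → root s ≡ just a × mainOf σ a ≡ just nullM) →
    Step past s (mkState (heap s) nothing)
  insAdd : ∀ i b xs ys → mainOf s i ≡ just (cnodeM (mkCNode b (xs ++ ys))) →
    (b' : ℕ) (e : Branch) →
    Step past s (setMain s i (cnodeM (mkCNode b' (xs ++ e ∷ ys))))
  insSNode : ∀ i b xs ys x → mainOf s i ≡ just (cnodeM (mkCNode b (xs ++ snodeRef x ∷ ys))) →
    (x' : SNode) →
    Step past s (setMain s i (cnodeM (mkCNode b (xs ++ snodeRef x' ∷ ys))))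
  insINode : ∀ i b xs ys x → mainOf s i ≡ just (cnodeM (mkCNode b (xs ++ snodeRef x ∷ ys))) →
    (m : Main) →
    Step past s (setMain (alloc s m) i (cnodeM (mkCNode b (xs ++ inodeRef (fresh s) ∷ ys))))
  remove : ∀ i b xs ys x → mainOf s i ≡ just (cnodeM (mkCNode b (xs ++ snodeRef x ∷ ys))) →
    (b' : ℕ) →
    Step past s (setMain s i (cnodeOrNull b' (xs ++ ys)))
  compress : ∀ {σ} i m → σ ∈ s ∷ past → mainOf s i ≡ just (cnodeM m) →
    (b' : ℕ) →
    Step past s (setMain s i (compression σ m b'))
  weakTomb : ∀ {σ} i m → σ ∈ s ∷ past → mainOf s i ≡ just (cnodeM m) →
    (b' : ℕ) →
    Step past s (setMain s i (weakTombing σ m b'))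
  cleanNull : ∀ {σ} p b xs ys j → σ ∈ s ∷ past →
    mainOf s p ≡ just (cnodeM (mkCNode b (xs ++ inodeRef j ∷ ys))) →
    mainOf σ j ≡ just nullM →
    (b' : ℕ) →
    Step past s (setMain s p (cnodeM (mkCNode b' (xs ++ ys))))
  cleanTomb : ∀ {σ} p b xs ys j x → σ ∈ s ∷ past →
    mainOf s p ≡ just (cnodeM (mkCNode b (xs ++ inodeRef j ∷ ys))) →
    mainOf σ j ≡ just (snodeM x) → tomb x ≡ true →
    Step past s (setMain s p (cnodeM (mkCNode b (xs ++ snodeRef (untomb x) ∷ ys))))

-- executions from the initial state; the list holds the states, latest first
data Execution : List State → Set where
  start : Execution (initial ∷ [])
  step  : ∀ {s past s'} → Execution (s ∷ past) → Step past s s' →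
          Execution (s' ∷ s ∷ past)

data MakesUnreachable (s s' : State) (n : ℕ) : Set where
  fromINode : ∀ p c → mainOf s p ≡ just (cnodeM c) → inodeRef n ∈ array c →
    ¬ (Σ CNode λ c' → mainOf s' p ≡ just (cnodeM c') × inodeRef n ∈ array c') →
    MakesUnreachable s s' n
  fromRoot : root s ≡ just n → root s' ≢ just n →
    MakesUnreachable s s' n

-- A successful CAS overwrites only a cnode (or the root), and the only steps
-- that can drop an inode entry of a cnode are the compression, the weak
-- tombing and the parent cleanups; each of them drops the entry only after a
-- read showing the inode nonlive, and the root is swung away only from a
-- null-inode.  So the inode was nonlive at some earlier snapshot, and it stays
-- nonlive since null and tombed mains are never overwritten.
module Submission where

open import Defs
open import Data.Nat using (ℕ; zero; suc; _≟_)
open import Data.List using (List; []; _∷_; _++_; [_])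
open import Data.List.Membership.Propositional using (_∈_; lose)
open import Data.List.Membership.Propositional.Properties using (∈-++⁺ˡ; ∈-++⁺ʳ; ∈-++⁻)
open import Data.List.Relation.Unary.Any using (Any; here; there)
open import Data.Bool using (true; false)
open import Data.Maybe using (just; nothing)
open import Data.Maybe.Properties using (just-injective)
open import Data.Product using (Σ; _×_; _,_)
open import Data.Sum using (_⊎_; inj₁; inj₂; map₁; map₂)
open import Data.Empty using (⊥-elim)
open import Relation.Nullary using (yes; no)
open import Relation.Binary.PropositionalEquality using (_≡_; _≢_; refl; sym; trans; cong; subst)

lookup-update-≢ : {A : Set} (xs : List A) {i a : ℕ} (v : A) → a ≢ i → update xs i v ! a ≡ xs ! a
lookup-update-≢ []       {i}     {a}     v a≢i = refl
lookup-update-≢ (x ∷ xs) {zero}  {zero}  v a≢i = ⊥-elim (a≢i refl)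
lookup-update-≢ (x ∷ xs) {zero}  {suc a} v a≢i = refl
lookup-update-≢ (x ∷ xs) {suc i} {zero}  v a≢i = refl
lookup-update-≢ (x ∷ xs) {suc i} {suc a} v a≢i = lookup-update-≢ xs v (λ a≡i → a≢i (cong suc a≡i))

lookup-update-≡ : {A : Set} (xs : List A) {i : ℕ} {w : A} (v : A) → xs ! i ≡ just w →
  update xs i v ! i ≡ just v
lookup-update-≡ (x ∷ xs) {zero}  v _   = refl
lookup-update-≡ (x ∷ xs) {suc i} v xs!i = lookup-update-≡ xs v xs!i

lookup-++ˡ : {A : Set} (xs ys : List A) {a : ℕ} {v : A} → xs ! a ≡ just v → (xs ++ ys) ! a ≡ just v
lookup-++ˡ (x ∷ xs) ys {zero}  xs!a = xs!a
lookup-++ˡ (x ∷ xs) ys {suc a} xs!a = lookup-++ˡ xs ys xs!a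

mainOf-cnode-unique : ∀ {s a c d} → mainOf s a ≡ just (cnodeM c) → mainOf s a ≡ just (cnodeM d) → c ≡ d
mainOf-cnode-unique s[a]≡c s[a]≡d with trans (sym s[a]≡c) s[a]≡d
... | refl = refl

∈-++-insert : {A : Set} {v e : A} (xs {ys} : List A) → v ∈ xs ++ ys → v ∈ xs ++ e ∷ ys
∈-++-insert xs v∈ with ∈-++⁻ xs v∈
... | inj₁ v∈xs = ∈-++⁺ˡ v∈xs
... | inj₂ v∈ys = ∈-++⁺ʳ xs (there v∈ys)

∈-++-remove : {A : Set} {v e : A} (xs {ys} : List A) → v ∈ xs ++ e ∷ ys → v ≡ e ⊎ v ∈ xs ++ ys
∈-++-remove xs v∈ with ∈-++⁻ xs v∈
... | inj₁ v∈xs         = inj₂ (∈-++⁺ˡ v∈xs)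
... | inj₂ (here v≡e)   = inj₁ v≡e
... | inj₂ (there v∈ys) = inj₂ (∈-++⁺ʳ xs v∈ys)

inode∈-without-snode : ∀ {n x} (xs {ys} : List Branch) → inodeRef n ∈ xs ++ snodeRef x ∷ ys →
  inodeRef n ∈ xs ++ ys
inode∈-without-snode xs n∈ with ∈-++-remove xs n∈
... | inj₂ n∈′ = n∈′

ChildOf : Main → ℕ → Set
ChildOf w n = Σ CNode λ c → w ≡ cnodeM c × inodeRef n ∈ array c

cnodeOrNull-child : ∀ {n} b' (es : List Branch) → inodeRef n ∈ es → ChildOf (cnodeOrNull b' es) n
cnodeOrNull-child b' (e ∷ es) n∈ = mkCNode b' (e ∷ es) , refl , n∈

statusMain≡nullI : ∀ mm → statusMain mm ≡ nullI → mm ≡ just nullM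
statusMain≡nullI (just nullM) _ = refl
statusMain≡nullI (just (snodeM x)) eq with tomb x
statusMain≡nullI (just (snodeM x)) () | true
statusMain≡nullI (just (snodeM x)) () | false

statusMain≡tombI : ∀ mm {x} → statusMain mm ≡ tombI x → mm ≡ just (snodeM x) × tomb x ≡ true
statusMain≡tombI (just (snodeM y)) eq with tomb y in tomb-y
statusMain≡tombI (just (snodeM y)) refl | true = refl , tomb-y
statusMain≡tombI (just (snodeM y)) ()   | false

status≡nullI⇒nonlive : ∀ {σ n} → status σ n ≡ nullI → Nonlive σ n
status≡nullI⇒nonlive {σ} {n} eq = inj₁ (statusMain≡nullI (mainOf σ n) eq)

status≡tombI⇒nonlive : ∀ {σ n x} → status σ n ≡ tombI x → Nonlive σ n
status≡tombI⇒nonlive {σ} {n} {x} eq = inj₂ (x , statusMain≡tombI (mainOf σ n) eq)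

compressEntries-keeps-child : ∀ σ {n} bs → inodeRef n ∈ bs → Nonlive σ n ⊎ inodeRef n ∈ compressEntries σ bs
compressEntries-keeps-child σ (snodeRef x ∷ bs) (there n∈) = map₂ there (compressEntries-keeps-child σ bs n∈)
compressEntries-keeps-child σ (inodeRef i ∷ bs) n∈ with status σ i in eq
compressEntries-keeps-child σ (inodeRef i ∷ bs) (here refl) | nullI   = inj₁ (status≡nullI⇒nonlive {σ} eq)
compressEntries-keeps-child σ (inodeRef i ∷ bs) (there n∈)  | nullI   = compressEntries-keeps-child σ bs n∈
compressEntries-keeps-child σ (inodeRef i ∷ bs) (here refl) | tombI x = inj₁ (status≡tombI⇒nonlive {σ} eq)
compressEntries-keeps-child σ (inodeRef i ∷ bs) (there n∈)  | tombI x = map₂ there (compressEntries-keeps-child σ bs n∈)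
compressEntries-keeps-child σ (inodeRef i ∷ bs) (here n≡i)  | otherI  = inj₂ (here n≡i)
compressEntries-keeps-child σ (inodeRef i ∷ bs) (there n∈)  | otherI  = map₂ there (compressEntries-keeps-child σ bs n∈)

compressGeneral-keeps-child : ∀ σ {n} m b' → inodeRef n ∈ array m →
  Nonlive σ n ⊎ ChildOf (compressGeneral σ m b') n
compressGeneral-keeps-child σ m b' n∈ = map₂ (cnodeOrNull-child b' _) (compressEntries-keeps-child σ (array m) n∈)

compression-keeps-child : ∀ σ {n} m b' → inodeRef n ∈ array m → Nonlive σ n ⊎ ChildOf (compression σ m b') n
compression-keeps-child σ (mkCNode bm (snodeRef x ∷ bs))       b' n∈ = compressGeneral-keeps-child σ (mkCNode bm _) b' n∈
compression-keeps-child σ (mkCNode bm (inodeRef i ∷ e ∷ bs))   b' n∈ = compressGeneral-keeps-child σ (mkCNode bm _) b' n∈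
compression-keeps-child σ {n} (mkCNode bm (inodeRef .n ∷ [])) b' (here refl) with status σ n in eq
... | tombI x = inj₁ (status≡tombI⇒nonlive {σ} eq)
... | nullI   = compressGeneral-keeps-child σ (mkCNode bm _) b' (here refl)
... | otherI  = compressGeneral-keeps-child σ (mkCNode bm _) b' (here refl)

dropNull-keeps-child : ∀ σ {n} bs → inodeRef n ∈ bs → Nonlive σ n ⊎ inodeRef n ∈ dropNull σ bs
dropNull-keeps-child σ (snodeRef x ∷ bs) (there n∈) = map₂ there (dropNull-keeps-child σ bs n∈)
dropNull-keeps-child σ (inodeRef i ∷ bs) n∈ with status σ i in eq
dropNull-keeps-child σ (inodeRef i ∷ bs) (here refl) | nullI   = inj₁ (status≡nullI⇒nonlive {σ} eq)
dropNull-keeps-child σ (inodeRef i ∷ bs) (there n∈)  | nullI   = dropNull-keeps-child σ bs n∈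
dropNull-keeps-child σ (inodeRef i ∷ bs) (here n≡i)  | tombI x = inj₂ (here n≡i)
dropNull-keeps-child σ (inodeRef i ∷ bs) (there n∈)  | tombI x = map₂ there (dropNull-keeps-child σ bs n∈)
dropNull-keeps-child σ (inodeRef i ∷ bs) (here n≡i)  | otherI  = inj₂ (here n≡i)
dropNull-keeps-child σ (inodeRef i ∷ bs) (there n∈)  | otherI  = map₂ there (dropNull-keeps-child σ bs n∈)

weakTombFrom-keeps-child : ∀ σ {n} m b' ds → inodeRef n ∈ array m → inodeRef n ∈ ds →
  Nonlive σ n ⊎ ChildOf (weakTombFrom σ m b' ds) n
weakTombFrom-keeps-child σ m b' (e ∷ e′ ∷ ds) n∈m _ = inj₂ (m , refl , n∈m)
weakTombFrom-keeps-child σ {n} m b' (.(inodeRef n) ∷ []) _ (here refl) with status σ n in eq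
... | tombI x = inj₁ (status≡tombI⇒nonlive {σ} eq)
... | nullI   = inj₂ (_ , refl , here refl)
... | otherI  = inj₂ (_ , refl , here refl)

weakTombing-keeps-child : ∀ σ {n} m b' → inodeRef n ∈ array m → Nonlive σ n ⊎ ChildOf (weakTombing σ m b') n
weakTombing-keeps-child σ m b' n∈ with dropNull-keeps-child σ (array m) n∈
... | inj₁ nonlive = inj₁ nonlive
... | inj₂ n∈ds     = weakTombFrom-keeps-child σ m b' (dropNull σ (array m)) n∈ n∈ds

EverNonlive : List State → ℕ → Set
EverNonlive hist n = Any (λ σ → Nonlive σ n) hist

Extends : State → State → Set
Extends s t = ∀ {a v} → mainOf s a ≡ just v → mainOf t a ≡ just v

ReleasesRoot : List State → State → State → Set
ReleasesRoot past s s' = ∀ {n} → root s ≡ just n → root s' ≢ just n → EverNonlive (s ∷ past) n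

data Effect (past : List State) (s s' : State) : Set where
  extension : Extends s s' → ReleasesRoot past s s' → Effect past s s'
  rewriting : root s' ≡ root s → ∀ i c w →
    mainOf s i ≡ just (cnodeM c) → mainOf s' i ≡ just w →
    (∀ {a v} → a ≢ i → mainOf s a ≡ just v → mainOf s' a ≡ just v) →
    (∀ {n} → inodeRef n ∈ array c → EverNonlive (s ∷ past) n ⊎ ChildOf w n) →
    Effect past s s'

alloc-extends : ∀ s m → Extends s (alloc s m)
alloc-extends s m = lookup-++ˡ (heap s) [ m ]

rewriting-after : ∀ {past s t i c} w → Extends s t → mainOf s i ≡ just (cnodeM c) →
  (∀ {n} → inodeRef n ∈ array c → EverNonlive (s ∷ past) n ⊎ ChildOf w n) →
  root t ≡ root s → Effect past s (setMain t i w)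
rewriting-after {t = t} w ext s[i] children root-kept =
  rewriting root-kept _ _ w s[i] (lookup-update-≡ (heap t) w (ext s[i]))
    (λ a≢i s[a] → trans (lookup-update-≢ (heap t) w a≢i) (ext s[a])) children

rewriting-in-place : ∀ {past s i c} w → mainOf s i ≡ just (cnodeM c) →
  (∀ {n} → inodeRef n ∈ array c → EverNonlive (s ∷ past) n ⊎ ChildOf w n) →
  Effect past s (setMain s i w)
rewriting-in-place w s[i] children = rewriting-after w (λ s[a] → s[a]) s[i] children refl

root-guard⇒everNonlive : ∀ {past s σ n} → σ ∈ s ∷ past →
  (root s ≡ nothing ⊎ Σ ℕ λ a → root s ≡ just a × mainOf σ a ≡ just nullM) →
  root s ≡ just n → EverNonlive (s ∷ past) n
root-guard⇒everNonlive σ∈ (inj₁ root≡nothing) root≡n with trans (sym root≡n) root≡nothing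
... | ()
root-guard⇒everNonlive σ∈ (inj₂ (a , root≡a , σ[a])) root≡n with just-injective (trans (sym root≡n) root≡a)
... | refl = lose σ∈ (inj₁ σ[a])

step-effect : ∀ {past s s'} → Step past s s' → Effect past s s'
step-effect {s = s} (rootNew σ∈ guard m) =
  extension (alloc-extends s m) (λ root≡n _ → root-guard⇒everNonlive σ∈ guard root≡n)
step-effect (rootNull σ∈ guard) =
  extension (λ s[a] → s[a]) (λ root≡n _ → root-guard⇒everNonlive σ∈ guard root≡n)
step-effect (insAdd i b xs ys s[i] b' e) = rewriting-in-place _ s[i]
  (λ n∈ → inj₂ (_ , refl , ∈-++-insert xs n∈))
step-effect (insSNode i b xs ys x s[i] x') = rewriting-in-place _ s[i]
  (λ n∈ → inj₂ (_ , refl , ∈-++-insert xs (inode∈-without-snode xs n∈)))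
step-effect {s = s} (insINode i b xs ys x s[i] m) = rewriting-after _ (alloc-extends s m) s[i]
  (λ n∈ → inj₂ (_ , refl , ∈-++-insert xs (inode∈-without-snode xs n∈))) refl
step-effect (remove i b xs ys x s[i] b') = rewriting-in-place _ s[i]
  (λ n∈ → inj₂ (cnodeOrNull-child b' (xs ++ ys) (inode∈-without-snode xs n∈)))
step-effect (compress {σ} i m σ∈ s[i] b') = rewriting-in-place _ s[i]
  (λ n∈ → map₁ (lose σ∈) (compression-keeps-child σ m b' n∈))
step-effect (weakTomb {σ} i m σ∈ s[i] b') = rewriting-in-place _ s[i]
  (λ n∈ → map₁ (lose σ∈) (weakTombing-keeps-child σ m b' n∈))
step-effect {past} {s} (cleanNull q b xs ys j σ∈ s[q] σ[j] b') =
  rewriting-in-place _ s[q] children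
  where
  children : ∀ {n} → inodeRef n ∈ xs ++ inodeRef j ∷ ys →
    EverNonlive (s ∷ past) n ⊎ ChildOf (cnodeM (mkCNode b' (xs ++ ys))) n
  children n∈ with ∈-++-remove xs n∈
  ... | inj₁ refl = inj₁ (lose σ∈ (inj₁ σ[j]))
  ... | inj₂ n∈′  = inj₂ (_ , refl , n∈′)
step-effect {past} {s} (cleanTomb q b xs ys j x σ∈ s[q] σ[j] tomb-x) =
  rewriting-in-place _ s[q] children
  where
  children : ∀ {n} → inodeRef n ∈ xs ++ inodeRef j ∷ ys →
    EverNonlive (s ∷ past) n ⊎ ChildOf (cnodeM (mkCNode b (xs ++ snodeRef (untomb x) ∷ ys))) n
  children n∈ with ∈-++-remove xs n∈
  ... | inj₁ refl = inj₁ (lose σ∈ (inj₂ (x , σ[j] , tomb-x)))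
  ... | inj₂ n∈′  = inj₂ (_ , refl , ∈-++-insert xs n∈′)

NotCNode : Main → Set
NotCNode v = ∀ c → v ≢ cnodeM c

step-preserves-noncnode : ∀ {past s s' a v} → Step past s s' → mainOf s a ≡ just v → NotCNode v →
  mainOf s' a ≡ just v
step-preserves-noncnode {a = a} st s[a] v≢cnode with step-effect st
... | extension ext _ = ext s[a]
... | rewriting _ i c _ s[i] _ frame _ with a ≟ i
...   | no a≢i   = frame a≢i s[a]
...   | yes refl = ⊥-elim (v≢cnode c (just-injective (trans (sym s[a]) s[i])))

step-preserves-nonlive : ∀ {past s s' a} → Step past s s' → Nonlive s a → Nonlive s' a
step-preserves-nonlive st (inj₁ s[a]) = inj₁ (step-preserves-noncnode st s[a] λ _ ())
step-preserves-nonlive st (inj₂ (x , s[a] , tomb-x)) = inj₂ (x , step-preserves-noncnode st s[a] (λ _ ()) , tomb-x)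

everNonlive⇒nonlive : ∀ {s past n} → Execution (s ∷ past) → EverNonlive (s ∷ past) n → Nonlive s n
everNonlive⇒nonlive start (here (inj₁ ()))
everNonlive⇒nonlive start (here (inj₂ (_ , () , _)))
everNonlive⇒nonlive (step ex st) (here nonlive) = nonlive
everNonlive⇒nonlive (step ex st) (there ever) = step-preserves-nonlive st (everNonlive⇒nonlive ex ever)

unreachable⇒everNonlive : ∀ {past s s' n} → Step past s s' → MakesUnreachable s s' n →
  EverNonlive (s ∷ past) n
unreachable⇒everNonlive {s = s} st mu with step-effect st | mu
... | extension _ releases | fromRoot root≡n root′≢n = releases root≡n root′≢n
... | rewriting root-kept _ _ _ _ _ _ _ | fromRoot root≡n root′≢n = ⊥-elim (root′≢n (trans root-kept root≡n))
... | extension ext _ | fromINode p c s[p] n∈c not-child = ⊥-elim (not-child (c , ext s[p] , n∈c))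
... | rewriting _ i d w s[i] s′[i] frame children | fromINode p c s[p] n∈c not-child with p ≟ i
...   | no p≢i = ⊥-elim (not-child (c , frame p≢i s[p] , n∈c))
...   | yes refl with children (subst (λ c → _ ∈ array c) (mainOf-cnode-unique {s} s[p] s[i]) n∈c)
...     | inj₁ ever = ever
...     | inj₂ (c' , refl , n∈c') = ⊥-elim (not-child (c' , s′[i] , n∈c'))

lemma4 : ∀ {s s' : State} {past : List State} →
         Execution (s ∷ past) → Step past s s' →
         (n : ℕ) → MakesUnreachable s s' n → Nonlive s' n
lemma4 ex st n mu = step-preserves-nonlive st (everNonlive⇒nonlive ex (unreachable⇒everNonlive st mu))
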